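{- Let $G$ be a graph, let $b$ be an orientable balanced valuation of $G$, let $k$ be a positive integer, and let $S\subseteq V(G)$ with $\partial(S)\neq 0$. If $4<\phi(S,b)<4+\frac1k$, then $\partial(S)\ge 4k+5$.
   Context: For $S\subseteq V(G)$, $\partial(S)$ denotes the number of edges with exactly one end in $S$, and for $b:V(G)\to\mathbb{Z}$, $b(S)=\sum_{v\in S}b(v)$. A balanced valuation of $G$ is a map $b:V(G)\to\mathbb{Z}$ such that $b(S)\le\partial(S)$ for every $S\subseteq V(G)$ and $b(v)\equiv\partial(\{v\})\pmod 2$ for every vertex $v$. It is orientable if $b(S)<\partial(S)$ for every $S\subseteq V(G)$ with $\partial(S)\ne 0$. For such $S$ define $\phi(S,b)=\frac{\partial(S)+b(S)}{\partial(S)-b(S)}+1$. -}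

module Defs where

open import Data.Nat using (ℕ; zero; suc; pred)
open import Data.Bool using (Bool; true; false; if_then_else_; _xor_)
open import Data.Fin using (Fin)
open import Data.Fin.Subset using (Subset; ⁅_⁆)
open import Data.Vec using (lookup)
open import Data.List using (List; length; filterᵇ; allFin; foldr; map)
open import Data.Product using (_×_; _,_)
open import Data.Integer as ℤ using (ℤ; +_; _-_)
open import Data.Integer.Divisibility using (_∣_)
open import Data.Rational.Unnormalised using (ℚᵘ; mkℚᵘ; 1ℚᵘ) renaming (_+_ to _+ᵘ_)
open import Relation.Nullary using (¬_)
open import Relation.Binary.PropositionalEquality using (_≡_)

record Graph : Set where
  field
    n     : ℕ
    edges : List (Fin n × Fin n)
open Graph public

∂ : (G : Graph) → Subset (n G) → ℕ
∂ G S = length (filterᵇ (λ { (u , v) → lookup S u xor lookup S v }) (edges G))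

sumℤ : List ℤ → ℤ
sumℤ = foldr ℤ._+_ (+ 0)

bsum : (G : Graph) → (Fin (n G) → ℤ) → Subset (n G) → ℤ
bsum G b S = sumℤ (map (λ v → if lookup S v then b v else + 0) (allFin (n G)))

record Balanced (G : Graph) (b : Fin (n G) → ℤ) : Set where
  field
    bounded : ∀ (S : Subset (n G)) → bsum G b S ℤ.≤ + ∂ G S
    parity  : ∀ (v : Fin (n G)) → + 2 ∣ (b v - + ∂ G ⁅ v ⁆)

record Orientable (G : Graph) (b : Fin (n G) → ℤ) : Set where
  field
    balanced : Balanced G b
    strict   : ∀ (S : Subset (n G)) → ¬ (∂ G S ≡ 0) → bsum G b S ℤ.< + ∂ G S

-- φ(S,b) = (∂(S)+b(S))/(∂(S)−b(S)) + 1, as an unnormalised rational.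
-- The denominator is taken as |∂(S) − b(S)|; this equals ∂(S) − b(S)
-- whenever ∂(S) > b(S), which is the only situation where φ is used.
φ : (G : Graph) → (Fin (n G) → ℤ) → Subset (n G) → ℚᵘ
φ G b S = mkℚᵘ (+ ∂ G S ℤ.+ bsum G b S) (pred ℤ.∣ + ∂ G S - bsum G b S ∣) +ᵘ 1ℚᵘ

-- With t = ∂(S) − b(S) > 0 we have φ(S,b) = 2∂(S)/t, and t is even: modulo 2,
-- b(S) ≡ Σ_{v∈S} ∂({v}) ≡ ∂(S), because a non-loop edge uw contributes
-- [u ∈ S] + [w ∈ S] to the sum, which is odd exactly when uw crosses S, and loops
-- contribute to neither side; in the Boolean ring (xor, ∧) this is an exchange of
-- a double sum over vertices and edges.
-- Writing t = 2m, the bounds on φ become 4m < ∂(S) and ∂(S)·k < (4k+1)·m;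
-- the first gives ∂(S)·k ≥ 4mk + k, so k < m and ∂(S) ≥ 4m + 1 ≥ 4k + 5.
module Submission where

open import Defs
open import Data.Nat using (ℕ; NonZero; _+_; _*_; _≤_)
open import Data.Fin.Subset using (Subset)
open import Data.Fin using (Fin)
open import Data.Integer using (ℤ; +_)
open import Data.Product using (_×_)
open import Data.Rational.Unnormalised using (_/_) renaming (_<_ to _<ᵘ_; _+_ to _+ᵘ_)
open import Relation.Nullary using (¬_)
open import Relation.Binary.PropositionalEquality using (_≡_)

open import Algebra.Bundles using (CommutativeRing)
open import Data.Bool using (Bool; true; false; not; _∧_; _xor_; if_then_else_)
open import Data.Bool.Properties
  using (xor-∧-commutativeRing; not-distribˡ-xor; ∧-distribˡ-xor; ∧-identityʳ; ∧-zeroʳ; xor-identityʳ; if-float)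
open import Data.Fin using (zero) renaming (suc to fsuc)
open import Data.Fin.Subset using (⁅_⁆)
open import Data.Integer as ℤ using (_-_; +<+)
import Data.Integer.Divisibility as ℤᵘ
import Data.Integer.Divisibility.Signed as ℤˢ
open import Data.Integer.Properties using (pos-+; pos-*; drop‿+<+; +-monoˡ-<; +-inverseʳ)
import Data.Integer.Tactic.RingSolver as ℤ-Solver
import Data.List as List
open import Data.List using (List; []; _∷_; length; filterᵇ; allFin; tabulate; map)
open import Data.List.Properties using (map-tabulate; map-cong)
open import Data.Nat using (suc; _<_; s≤s)
open import Data.Nat.Divisibility using (_∣_; divides)
open import Data.Nat.ListAction using (sum)
open import Data.Nat.Properties
  using (+-identityʳ; *-identityʳ; *-cancelˡ-<; +-cancelˡ-<; *-monoʳ-≤; *-monoˡ-≤; module ≤-Reasoning)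
open import Data.Nat.Tactic.RingSolver using (solve)
open import Data.Product using (∃; _,_)
open import Data.Rational.Unnormalised using (_≃_; *≡*; *<*)
open import Data.Rational.Unnormalised.Properties using (<-respˡ-≃; <-respʳ-≃)
open import Data.Vec using (lookup)
open import Data.Vec.Properties using (lookup-replicate)
open import Function using (_∘_; id)
open import Relation.Binary.PropositionalEquality using (refl; sym; trans; cong; cong₂; subst; subst₂; module ≡-Reasoning)

-- ∑ is the xor-sum of Booleans, so it computes parities.
open CommutativeRing xor-∧-commutativeRing using (+-commutativeMonoid; semiring)
open import Algebra.Properties.CommutativeMonoid.Sum +-commutativeMonoid
  using (sum-syntax; sum-cong-≗; sum-replicate-zero; ∑-comm; ∑-distrib-+)
open import Algebra.Properties.Semiring.Sum semiring using (*-distribˡ-sum)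

odd : ℕ → Bool
odd 0             = false
odd 1             = true
odd (suc (suc n)) = odd n

odd-suc : ∀ n → odd (suc n) ≡ not (odd n)
odd-suc 0             = refl
odd-suc 1             = refl
odd-suc (suc (suc n)) = odd-suc n

odd-+ : ∀ m n → odd (m + n) ≡ odd m xor odd n
odd-+ 0       n = refl
odd-+ (suc m) n = begin
  odd (suc (m + n))      ≡⟨ odd-suc (m + n) ⟩
  not (odd (m + n))      ≡⟨ cong not (odd-+ m n) ⟩
  not (odd m xor odd n)  ≡⟨ not-distribˡ-xor (odd m) (odd n) ⟩
  not (odd m) xor odd n  ≡⟨ cong (_xor odd n) (sym (odd-suc m)) ⟩
  odd (suc m) xor odd n  ∎
  where open ≡-Reasoning

odd-if : ∀ s x → odd (if s then x else 0) ≡ (s ∧ odd x)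
odd-if true  x = refl
odd-if false x = refl

odd-sum-tabulate : ∀ {n} (f : Fin n → ℕ) → odd (sum (tabulate f)) ≡ ∑[ i < n ] odd (f i)
odd-sum-tabulate {0}     f = refl
odd-sum-tabulate {suc n} f =
  trans (odd-+ (f zero) _) (cong (odd (f zero) xor_) (odd-sum-tabulate (f ∘ fsuc)))

odd-length-filterᵇ : ∀ {A : Set} (p : A → Bool) (xs : List A) →
                     odd (length (filterᵇ p xs)) ≡ ∑[ i < length xs ] p (List.lookup xs i)
odd-length-filterᵇ p []       = refl
odd-length-filterᵇ p (x ∷ xs) with p x
... | true  = trans (odd-suc (length (filterᵇ p xs))) (cong not (odd-length-filterᵇ p xs))
... | false = odd-length-filterᵇ p xs

∑-∧-⁅⁆ : ∀ {n} (f : Fin n → Bool) (u : Fin n) → ∑[ v < n ] (f v ∧ lookup ⁅ v ⁆ u) ≡ f u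
∑-∧-⁅⁆ {suc n} f zero = begin
  (f zero ∧ true) xor ∑[ v < n ] (f (fsuc v) ∧ false)
    ≡⟨ cong₂ _xor_ (∧-identityʳ (f zero))
                   (trans (sum-cong-≗ (∧-zeroʳ ∘ f ∘ fsuc)) (sum-replicate-zero n)) ⟩
  f zero xor false
    ≡⟨ xor-identityʳ (f zero) ⟩
  f zero ∎
  where open ≡-Reasoning
∑-∧-⁅⁆ {suc n} f (fsuc u) = begin
  (f zero ∧ lookup ⁅ zero ⁆ (fsuc u)) xor ∑[ v < n ] (f (fsuc v) ∧ lookup ⁅ v ⁆ u)
    ≡⟨ cong (_xor ∑[ v < n ] (f (fsuc v) ∧ lookup ⁅ v ⁆ u))
            (trans (cong (f zero ∧_) (lookup-replicate u false)) (∧-zeroʳ (f zero))) ⟩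
  ∑[ v < n ] (f (fsuc v) ∧ lookup ⁅ v ⁆ u)
    ≡⟨ ∑-∧-⁅⁆ (f ∘ fsuc) u ⟩
  f (fsuc u) ∎
  where open ≡-Reasoning

-- Agrees definitionally with the predicate filtered in ∂, by η for pairs.
crosses : ∀ {n} → Subset n → Fin n × Fin n → Bool
crosses S (u , w) = lookup S u xor lookup S w

crosses≡∑-crosses-⁅⁆ : ∀ {n} (S : Subset n) (e : Fin n × Fin n) →
                       crosses S e ≡ ∑[ v < n ] (lookup S v ∧ crosses ⁅ v ⁆ e)
crosses≡∑-crosses-⁅⁆ {n} S (u , w) = sym (begin
  ∑[ v < n ] (lookup S v ∧ (lookup ⁅ v ⁆ u xor lookup ⁅ v ⁆ w))
    ≡⟨ sum-cong-≗ (λ v → ∧-distribˡ-xor (lookup S v) _ _) ⟩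
  ∑[ v < n ] ((lookup S v ∧ lookup ⁅ v ⁆ u) xor (lookup S v ∧ lookup ⁅ v ⁆ w))
    ≡⟨ ∑-distrib-+ (λ v → lookup S v ∧ lookup ⁅ v ⁆ u) (λ v → lookup S v ∧ lookup ⁅ v ⁆ w) ⟩
  ∑[ v < n ] (lookup S v ∧ lookup ⁅ v ⁆ u) xor ∑[ v < n ] (lookup S v ∧ lookup ⁅ v ⁆ w)
    ≡⟨ cong₂ _xor_ (∑-∧-⁅⁆ (lookup S) u) (∑-∧-⁅⁆ (lookup S) w) ⟩
  lookup S u xor lookup S w ∎)
  where open ≡-Reasoning

odd-∂≡∑-odd-∂⁅⁆ : ∀ G S → odd (∂ G S) ≡ ∑[ v < n G ] (lookup S v ∧ odd (∂ G ⁅ v ⁆))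
odd-∂≡∑-odd-∂⁅⁆ G S = begin
  odd (∂ G S)
    ≡⟨ odd-length-filterᵇ (crosses S) (edges G) ⟩
  ∑[ i < m ] crosses S (e i)
    ≡⟨ sum-cong-≗ (crosses≡∑-crosses-⁅⁆ S ∘ e) ⟩
  ∑[ i < m ] ∑[ v < n G ] (lookup S v ∧ crosses ⁅ v ⁆ (e i))
    ≡⟨ ∑-comm (λ i v → lookup S v ∧ crosses ⁅ v ⁆ (e i)) ⟩
  ∑[ v < n G ] ∑[ i < m ] (lookup S v ∧ crosses ⁅ v ⁆ (e i))
    ≡⟨ sum-cong-≗ (λ v → sym (*-distribˡ-sum (lookup S v) (crosses ⁅ v ⁆ ∘ e))) ⟩
  ∑[ v < n G ] (lookup S v ∧ ∑[ i < m ] crosses ⁅ v ⁆ (e i))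
    ≡⟨ sum-cong-≗ (λ v → cong (lookup S v ∧_) (sym (odd-length-filterᵇ (crosses ⁅ v ⁆) (edges G)))) ⟩
  ∑[ v < n G ] (lookup S v ∧ odd (∂ G ⁅ v ⁆)) ∎
  where
  open ≡-Reasoning
  m : ℕ
  m = length (edges G)
  e : Fin m → Fin (n G) × Fin (n G)
  e = List.lookup (edges G)

[2+i]-j≡[i-j]+2 : ∀ i j → (+ 2 ℤ.+ i) - j ≡ (i - j) ℤ.+ + 2
[2+i]-j≡[i-j]+2 = ℤ-Solver.solve-∀

i-[2+j]≡[i-j]-2 : ∀ i j → i - (+ 2 ℤ.+ j) ≡ (i - j) - + 2
i-[2+j]≡[i-j]-2 = ℤ-Solver.solve-∀

odd≡odd⇒2∣m-n : ∀ m n → odd m ≡ odd n → + 2 ℤˢ.∣ + m - + n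
odd≡odd⇒2∣m-n 0 0 _  = ℤˢ.divides (+ 0) refl
odd≡odd⇒2∣m-n 1 1 _  = ℤˢ.divides (+ 0) refl
odd≡odd⇒2∣m-n 0 1 ()
odd≡odd⇒2∣m-n 1 0 ()
odd≡odd⇒2∣m-n (suc (suc m)) n p = subst (+ 2 ℤˢ.∣_) (sym ([2+i]-j≡[i-j]+2 (+ m) (+ n)))
  (ℤˢ.∣m∣n⇒∣m+n (odd≡odd⇒2∣m-n m n p) ℤˢ.∣-refl)
odd≡odd⇒2∣m-n m (suc (suc n)) p = subst (+ 2 ℤˢ.∣_) (sym (i-[2+j]≡[i-j]-2 (+ m) (+ n)))
  (ℤˢ.∣m∣n⇒∣m-n (odd≡odd⇒2∣m-n m n p) ℤˢ.∣-refl)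

[a-b]+[c-d]≡[a+c]-[b+d] : ∀ a b c d → (a - b) ℤ.+ (c - d) ≡ (a ℤ.+ c) - (b ℤ.+ d)
[a-b]+[c-d]≡[a+c]-[b+d] = ℤ-Solver.solve-∀

∣-sumℤ-map : ∀ {A : Set} {k} (f g : A → ℤ) (xs : List A) → (∀ x → k ℤˢ.∣ f x - g x) →
             k ℤˢ.∣ sumℤ (map f xs) - sumℤ (map g xs)
∣-sumℤ-map f g []       _     = ℤˢ.divides (+ 0) refl
∣-sumℤ-map f g (x ∷ xs) k∣f-g = subst (_ ℤˢ.∣_) ([a-b]+[c-d]≡[a+c]-[b+d] (f x) (g x) _ _)
  (ℤˢ.∣m∣n⇒∣m+n (k∣f-g x) (∣-sumℤ-map f g xs k∣f-g))

sumℤ-map-+ : ∀ {A : Set} (f : A → ℕ) (xs : List A) → sumℤ (map (+_ ∘ f) xs) ≡ + sum (map f xs)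
sumℤ-map-+ f []       = refl
sumℤ-map-+ f (x ∷ xs) = trans (cong (ℤ._+_ (+ f x)) (sumℤ-map-+ f xs)) (sym (pos-+ (f x) _))

bsum-cong-∣ : ∀ {G b c k} (S : Subset (n G)) → (∀ v → k ℤˢ.∣ b v - c v) →
              k ℤˢ.∣ bsum G b S - bsum G c S
bsum-cong-∣ {G} {b} {c} {k} S k∣b-c = ∣-sumℤ-map _ _ (allFin (n G)) k∣restriction
  where
  k∣restriction : ∀ v → k ℤˢ.∣ (if lookup S v then b v else + 0) - (if lookup S v then c v else + 0)
  k∣restriction v with lookup S v
  ... | true  = k∣b-c v
  ... | false = ℤˢ.divides (+ 0) refl

2∣∂-bsum-∂⁅⁆ : ∀ G S → + 2 ℤˢ.∣ + ∂ G S - bsum G (λ v → + ∂ G ⁅ v ⁆) S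
2∣∂-bsum-∂⁅⁆ G S =
  subst (λ x → + 2 ℤˢ.∣ + ∂ G S - x) (sym bsum≡D) (odd≡odd⇒2∣m-n (∂ G S) D (sym odd-D≡odd-∂))
  where
  open ≡-Reasoning
  deg : Fin (n G) → ℕ
  deg v = if lookup S v then ∂ G ⁅ v ⁆ else 0
  D : ℕ
  D = sum (map deg (allFin (n G)))
  bsum≡D : bsum G (λ v → + ∂ G ⁅ v ⁆) S ≡ + D
  bsum≡D = trans (cong sumℤ (map-cong (λ v → sym (if-float +_ (lookup S v))) (allFin (n G))))
                 (sumℤ-map-+ deg (allFin (n G)))
  odd-D≡odd-∂ : odd D ≡ odd (∂ G S)
  odd-D≡odd-∂ = begin
    odd (sum (map deg (allFin (n G))))           ≡⟨ cong (odd ∘ sum) (map-tabulate id deg) ⟩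
    odd (sum (tabulate deg))                     ≡⟨ odd-sum-tabulate deg ⟩
    ∑[ v < n G ] odd (deg v)                     ≡⟨ sum-cong-≗ (λ v → odd-if (lookup S v) (∂ G ⁅ v ⁆)) ⟩
    ∑[ v < n G ] (lookup S v ∧ odd (∂ G ⁅ v ⁆))  ≡⟨ sym (odd-∂≡∑-odd-∂⁅⁆ G S) ⟩
    odd (∂ G S)                                  ∎

[a-b]+[b-c]≡a-c : ∀ a b c → (a - b) ℤ.+ (b - c) ≡ a - c
[a-b]+[b-c]≡a-c = ℤ-Solver.solve-∀

-[a-b]≡b-a : ∀ a b → ℤ.- (a - b) ≡ b - a
-[a-b]≡b-a = ℤ-Solver.solve-∀

Balanced⇒2∣∂-bsum : ∀ {G b} → Balanced G b → ∀ S → + 2 ℤᵘ.∣ + ∂ G S - bsum G b S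
Balanced⇒2∣∂-bsum {G} {b} B S = ℤˢ.∣⇒∣ᵤ
  (subst (+ 2 ℤˢ.∣_) ([a-b]+[b-c]≡a-c (+ ∂ G S) (bsum G (λ v → + ∂ G ⁅ v ⁆) S) (bsum G b S))
         (ℤˢ.∣m∣n⇒∣m+n (2∣∂-bsum-∂⁅⁆ G S) (bsum-cong-∣ {G} S 2∣∂⁅⁆-b)))
  where
  2∣∂⁅⁆-b : ∀ v → + 2 ℤˢ.∣ + ∂ G ⁅ v ⁆ - b v
  2∣∂⁅⁆-b v = subst (+ 2 ℤˢ.∣_) (-[a-b]≡b-a (b v) (+ ∂ G ⁅ v ⁆))
                    (ℤˢ.∣m⇒∣-m (ℤˢ.∣ᵤ⇒∣ (Balanced.parity B v)))

i<j⇒j-i≡1+q : ∀ {i j} → i ℤ.< j → ∃ λ q → j - i ≡ + suc q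
i<j⇒j-i≡1+q {i} {j} i<j = positive (subst (ℤ._< j - i) (+-inverseʳ i) (+-monoˡ-< (ℤ.- i) i<j))
  where
  positive : ∀ {x} → + 0 ℤ.< x → ∃ λ q → x ≡ + suc q
  positive {+ suc q} _       = q , refl
  positive {+ 0}     (+<+ ())

[d+s]*1+1*[d-s]≡2d : ∀ d s → (d ℤ.+ s) ℤ.* + 1 ℤ.+ + 1 ℤ.* (d - s) ≡ + 2 ℤ.* d
[d+s]*1+1*[d-s]≡2d = ℤ-Solver.solve-∀

φ≃2∂/[∂-b] : ∀ G b S {q} → + ∂ G S - bsum G b S ≡ + suc q → φ G b S ≃ + (2 * ∂ G S) / suc q
φ≃2∂/[∂-b] G b S {q} ∂-b≡1+q rewrite ∂-b≡1+q =
  *≡* (cong₂ ℤ._*_ numerator≡2∂ (cong (+_ ∘ suc) (sym (*-identityʳ q))))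
  where
  open ≡-Reasoning
  numerator≡2∂ : (+ ∂ G S ℤ.+ bsum G b S) ℤ.* + 1 ℤ.+ + 1 ℤ.* + suc q ≡ + (2 * ∂ G S)
  numerator≡2∂ = begin
    (+ ∂ G S ℤ.+ bsum G b S) ℤ.* + 1 ℤ.+ + 1 ℤ.* + suc q
      ≡⟨ cong (λ t → (+ ∂ G S ℤ.+ bsum G b S) ℤ.* + 1 ℤ.+ + 1 ℤ.* t) (sym ∂-b≡1+q) ⟩
    (+ ∂ G S ℤ.+ bsum G b S) ℤ.* + 1 ℤ.+ + 1 ℤ.* (+ ∂ G S - bsum G b S)
      ≡⟨ [d+s]*1+1*[d-s]≡2d (+ ∂ G S) (bsum G b S) ⟩
    + 2 ℤ.* + ∂ G S
      ≡⟨ sym (pos-* 2 (∂ G S)) ⟩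
    + (2 * ∂ G S) ∎

4+1/k≃[4k+1]/k : ∀ k .{{_ : NonZero k}} → (+ 4 / 1) +ᵘ (+ 1 / k) ≃ + (4 * k + 1) / k
4+1/k≃[4k+1]/k (suc k) = *≡* (cong (λ j → + (4 * suc k + 1) ℤ.* + suc j) (sym (+-identityʳ k)))

+a/c<+b/e⇒a*e<b*c : ∀ {a b c e} .{{_ : NonZero c}} .{{_ : NonZero e}} →
                    + a / c <ᵘ + b / e → a * e < b * c
+a/c<+b/e⇒a*e<b*c {a} {b} {suc c} {suc e} (*<* a*e<b*c) =
  drop‿+<+ (subst₂ ℤ._<_ (sym (pos-* a (suc e))) (sym (pos-* b (suc c))) a*e<b*c)

4m<d⇒dk<[4k+1]m⇒4k+5≤d : ∀ d m k → 4 * m < d → d * k < (4 * k + 1) * m → 4 * k + 5 ≤ d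
4m<d⇒dk<[4k+1]m⇒4k+5≤d d m k 4m<d dk<[4k+1]m = begin
  4 * k + 5        ≡⟨ solve (k ∷ []) ⟩
  suc (4 * suc k)  ≤⟨ s≤s (*-monoʳ-≤ 4 k<m) ⟩
  suc (4 * m)      ≤⟨ 4m<d ⟩
  d                ∎
  where
  open ≤-Reasoning
  k<m : k < m
  k<m = +-cancelˡ-< (4 * m * k) k m (begin-strict
    4 * m * k + k    ≡⟨ solve (m ∷ k ∷ []) ⟩
    suc (4 * m) * k  ≤⟨ *-monoˡ-≤ k 4m<d ⟩
    d * k            <⟨ dk<[4k+1]m ⟩
    (4 * k + 1) * m  ≡⟨ solve (m ∷ k ∷ []) ⟩
    4 * m * k + m    ∎)

2∣t⇒4t<2d⇒2dk<[4k+1]t⇒4k+5≤d : ∀ d t k → 2 ∣ t → 4 * t < 2 * d → 2 * d * k < (4 * k + 1) * t →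
                                4 * k + 5 ≤ d
2∣t⇒4t<2d⇒2dk<[4k+1]t⇒4k+5≤d d .(m * 2) k (divides m refl) 4t<2d 2dk<[4k+1]t =
  4m<d⇒dk<[4k+1]m⇒4k+5≤d d m k
    (*-cancelˡ-< 2 (4 * m) d (subst (_< 2 * d) 4[2m]≡2[4m] 4t<2d))
    (*-cancelˡ-< 2 (d * k) ((4 * k + 1) * m) (subst₂ _<_ 2d*k≡2[dk] [4k+1][2m]≡2[[4k+1]m] 2dk<[4k+1]t))
  where
  4[2m]≡2[4m] : 4 * (m * 2) ≡ 2 * (4 * m)
  4[2m]≡2[4m] = solve (m ∷ [])
  2d*k≡2[dk] : 2 * d * k ≡ 2 * (d * k)
  2d*k≡2[dk] = solve (d ∷ k ∷ [])
  [4k+1][2m]≡2[[4k+1]m] : (4 * k + 1) * (m * 2) ≡ 2 * ((4 * k + 1) * m)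
  [4k+1][2m]≡2[[4k+1]m] = solve (m ∷ k ∷ [])

lemma6 : (G : Graph) (b : Fin (n G) → ℤ) → Orientable G b →
         (k : ℕ) .{{_ : NonZero k}} →
         (S : Subset (n G)) → ¬ (∂ G S ≡ 0) →
         (+ 4 / 1) <ᵘ φ G b S → φ G b S <ᵘ ((+ 4 / 1) +ᵘ (+ 1 / k)) →
         4 * k + 5 ≤ ∂ G S
lemma6 G b O k S ∂≢0 4<φ φ<4+1/k with i<j⇒j-i≡1+q (Orientable.strict O S ∂≢0)
... | q , ∂-b≡1+q = 2∣t⇒4t<2d⇒2dk<[4k+1]t⇒4k+5≤d (∂ G S) (suc q) k 2∣∂-b 4[∂-b]<2∂ 2∂k<[4k+1][∂-b]
  where
  2∣∂-b : 2 ∣ suc q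
  2∣∂-b = subst (+ 2 ℤᵘ.∣_) ∂-b≡1+q (Balanced⇒2∣∂-bsum (Orientable.balanced O) S)
  φ≃ : φ G b S ≃ + (2 * ∂ G S) / suc q
  φ≃ = φ≃2∂/[∂-b] G b S ∂-b≡1+q
  4[∂-b]<2∂ : 4 * suc q < 2 * ∂ G S
  4[∂-b]<2∂ = subst (4 * suc q <_) (*-identityʳ (2 * ∂ G S)) (+a/c<+b/e⇒a*e<b*c (<-respʳ-≃ φ≃ 4<φ))
  2∂k<[4k+1][∂-b] : 2 * ∂ G S * k < (4 * k + 1) * suc q
  2∂k<[4k+1][∂-b] = +a/c<+b/e⇒a*e<b*c (<-respʳ-≃ (4+1/k≃[4k+1]/k k) (<-respˡ-≃ φ≃ φ<4+1/k))
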